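{- Let $p\geq 1$ and $n\geq p+1$ be integers. Then the number of edges of the Fibonacci $p$-cube $\Gamma^{p}_{n}$ is $$|E(\Gamma^{p}_{n})|=\sum_{i=1}^{n}F^{p}_{i}F^{p}_{n-i+1}.$$
   Context: For $p\geq 1$, the Fibonacci $p$-numbers are defined by $F^p_0=0$, $F^p_1=F^p_2=\cdots=F^p_p=1$, and $F^p_n=F^p_{n-1}+F^p_{n-p-1}$ for $n>p$. A Fibonacci $p$-string of length $n$ is a binary string of length $n$ in which any two 1s are separated by at least $p$ 0s. The Fibonacci $p$-cube $\Gamma^p_n$ is the subgraph of the hypercube $Q_n$ (vertices: binary strings of length $n$, adjacent iff they differ in exactly one coordinate) induced by all Fibonacci $p$-strings of length $n$. -}

module Defs where

open import Data.Nat using (ℕ; zero; suc; _+_; _∸_; _<_; _≤_; _<ᵇ_; _≤ᵇ_; _≡ᵇ_)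
open import Data.Bool using (Bool; true; false; if_then_else_; _∧_; _xor_)
open import Data.Maybe using (Maybe; nothing; just)
import Data.Maybe
open import Data.Vec using (Vec; []; _∷_; lookup)
open import Data.List using (List; []; _∷_; map; filterᵇ; length; _++_)
open import Data.Product using (_×_; _,_; proj₁; proj₂)

-- Fibonacci p-numbers: F^p_0 = 0, F^p_1 = … = F^p_p = 1,
-- F^p_n = F^p_(n-1) + F^p_(n-p-1) for n > p.
-- Computed with a fuel argument k (the recursion on n is not structural);
-- Fib p n = Fib-aux p n n, and fuel n suffices since every recursive call
-- has a strictly smaller index.
Fib-aux : (p fuel n : ℕ) → ℕ
Fib-aux p zero n = 0
Fib-aux p (suc k) zero = 0
Fib-aux p (suc k) (suc m) =
  if p <ᵇ suc m
  then Fib-aux p k m + Fib-aux p k (suc m ∸ suc p)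
  else 1

F : ℕ → ℕ → ℕ
F p n = Fib-aux p n n

BinStr : ℕ → Set
BinStr n = Vec Bool n

allStrings : (n : ℕ) → List (BinStr n)
allStrings zero = [] ∷ []
allStrings (suc n) = map (false ∷_) (allStrings n) ++ map (true ∷_) (allStrings n)

-- A Fibonacci p-string: any two 1s are separated by at least p 0s.
-- Boolean check scanning left to right; `gap` is the number of 0s seen since
-- the last 1 (or `nothing` if no 1 has been seen yet).  A new 1 is allowed
-- iff no earlier 1 exists or at least p 0s occurred since the previous 1.
-- (Two 1s separated by fewer than p 0s with a 1 in between already
-- yields an adjacent pair of 1s with fewer than p 0s between them.)
fibCheck : (p : ℕ) → Maybe ℕ → {n : ℕ} → BinStr n → Bool
fibCheck p gap [] = true
fibCheck p gap (false ∷ u) = fibCheck p (Data.Maybe.map suc gap) u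
fibCheck p nothing (true ∷ u) = fibCheck p (just 0) u
fibCheck p (just g) (true ∷ u) = (p ≤ᵇ g) ∧ fibCheck p (just 0) u

isFibString : (p : ℕ) {n : ℕ} → BinStr n → Bool
isFibString p u = fibCheck p nothing u

hamming : {n : ℕ} → BinStr n → BinStr n → ℕ
hamming [] [] = 0
hamming (a ∷ u) (b ∷ v) = (if a xor b then 1 else 0) + hamming u v

adjacent : {n : ℕ} → BinStr n → BinStr n → Bool
adjacent u v = hamming u v ≡ᵇ 1

pairs : {A : Set} → List A → List (A × A)
pairs [] = []
pairs (x ∷ xs) = map (x ,_) xs ++ pairs xs

vertices : (p n : ℕ) → List (BinStr n)
vertices p n = filterᵇ (isFibString p) (allStrings n)

edges : (p n : ℕ) → List (BinStr n × BinStr n)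
edges p n = filterᵇ (λ e → adjacent (proj₁ e) (proj₂ e)) (pairs (vertices p n))

sum1 : ℕ → (ℕ → ℕ) → ℕ
sum1 zero f = 0
sum1 (suc n) f = sum1 n f + f (suc n)

-- Let V_s(n) be the Fibonacci p-strings of length n whose first s letters are 0.
-- Splitting off the first letter gives V_0(n+1) = 0·V_0(n) ∪ 1·V_p(n) and
-- V_(s+1)(n+1) = 0·V_s(n).  An edge of Γ^p_(n+1) lies inside one of the two parts
-- or joins 1u to 0u for u ∈ V_p(n) ⊆ V_0(n), so e(n+1) = e(n) + e(n-p) + |V_p(n)|,
-- and |V_p(n)| = F^p_(n+1).  Applying F^p_(k+1) = F^p_k + F^p_(k-p) to the second
-- factor shows that the convolution Σ_i F^p_i F^p_(n-i+1) obeys the same recurrence.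
module Submission where

open import Defs
open import Data.Nat using (ℕ; zero; suc; pred; _+_; _*_; _∸_; _≤_; _<ᵇ_; _≤ᵇ_; _≡ᵇ_; z≤n; s≤s)
open import Data.Nat.Properties
open import Data.Nat.Tactic.RingSolver using (solve-∀)
open import Algebra.Properties.CommutativeSemigroup +-commutativeSemigroup using (interchange)
open import Data.Bool using (Bool; true; false; T; if_then_else_)
open import Data.Maybe using (Maybe; nothing; just)
open import Data.Vec using ([]; _∷_)
open import Data.List using (List; []; _∷_; map; filterᵇ; length; _++_)
open import Data.Nat.ListAction using (sum)
open import Data.List.Properties using (length-++; length-map; map-∘; map-cong; ++-identityʳ; filter-++; filter-≐)
open import Data.Product using (_,_; uncurry)
open import Data.Empty using (⊥-elim)
open import Function using (_∘_)
open import Relation.Nullary using (ofʸ; ofⁿ; contradiction)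
open import Relation.Nullary.Decidable using (T?)
open import Relation.Binary.PropositionalEquality
open ≡-Reasoning

module _ {A : Set} where

  countᵇ : (A → Bool) → List A → ℕ
  countᵇ P xs = length (filterᵇ P xs)

  countᵇ-++ : ∀ (P : A → Bool) xs ys → countᵇ P (xs ++ ys) ≡ countᵇ P xs + countᵇ P ys
  countᵇ-++ P xs ys = trans (cong length (filter-++ (T? ∘ P) xs ys)) (length-++ (filterᵇ P xs))

  filterᵇ-cong : ∀ {P Q : A → Bool} → P ≗ Q → filterᵇ P ≗ filterᵇ Q
  filterᵇ-cong {P} {Q} P≗Q =
    filter-≐ (T? ∘ P) (T? ∘ Q) ((λ {x} → subst T (P≗Q x)) , (λ {x} → subst T (sym (P≗Q x))))

  filterᵇ-false : ∀ (xs : List A) → filterᵇ (λ _ → false) xs ≡ []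
  filterᵇ-false []       = refl
  filterᵇ-false (_ ∷ xs) = filterᵇ-false xs

  filterᵇ-comm : ∀ (P Q : A → Bool) xs → filterᵇ P (filterᵇ Q xs) ≡ filterᵇ Q (filterᵇ P xs)
  filterᵇ-comm P Q [] = refl
  filterᵇ-comm P Q (x ∷ xs) with P x in Px | Q x in Qx
  ... | true  | true  rewrite Px | Qx = cong (x ∷_) (filterᵇ-comm P Q xs)
  ... | true  | false rewrite Qx = filterᵇ-comm P Q xs
  ... | false | true  rewrite Px = filterᵇ-comm P Q xs
  ... | false | false = filterᵇ-comm P Q xs

  filterᵇ-absorb : ∀ {P Q : A → Bool} → (∀ x → T (Q x) → T (P x)) →
                   filterᵇ Q ∘ filterᵇ P ≗ filterᵇ Q
  filterᵇ-absorb Q⇒P [] = refl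
  filterᵇ-absorb {P} {Q} Q⇒P (x ∷ xs) with P x | Q x in Qx | Q⇒P x
  ... | true  | true  | _     rewrite Qx = cong (x ∷_) (filterᵇ-absorb Q⇒P xs)
  ... | true  | false | _     rewrite Qx = filterᵇ-absorb Q⇒P xs
  ... | false | true  | Qx⇒Px = ⊥-elim (Qx⇒Px _)
  ... | false | false | _     = filterᵇ-absorb Q⇒P xs

  sum-countᵇ-singleton : ∀ (P : A → Bool) xs → sum (map (λ x → countᵇ P (x ∷ [])) xs) ≡ countᵇ P xs
  sum-countᵇ-singleton P [] = refl
  sum-countᵇ-singleton P (x ∷ xs) with P x
  ... | true  = cong suc (sum-countᵇ-singleton P xs)
  ... | false = sum-countᵇ-singleton P xs

module _ {A B : Set} where

  filterᵇ-map : ∀ (P : B → Bool) (f : A → B) → filterᵇ P ∘ map f ≗ map f ∘ filterᵇ (P ∘ f)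
  filterᵇ-map P f [] = refl
  filterᵇ-map P f (x ∷ xs) with P (f x)
  ... | true  = cong (f x ∷_) (filterᵇ-map P f xs)
  ... | false = filterᵇ-map P f xs

  countᵇ-map : ∀ (P : B → Bool) (f : A → B) xs → countᵇ P (map f xs) ≡ countᵇ (P ∘ f) xs
  countᵇ-map P f xs = trans (cong length (filterᵇ-map P f xs)) (length-map f (filterᵇ (P ∘ f) xs))

edgeCount : ∀ {n} → List (BinStr n) → ℕ
edgeCount xs = countᵇ (uncurry adjacent) (pairs xs)

crossEdgeCount : ∀ {n} → List (BinStr n) → List (BinStr n) → ℕ
crossEdgeCount xs ys = sum (map (λ x → countᵇ (adjacent x) ys) xs)

edgeCount-∷ : ∀ {n} (x : BinStr n) xs → edgeCount (x ∷ xs) ≡ countᵇ (adjacent x) xs + edgeCount xs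
edgeCount-∷ x xs = begin
  edgeCount (x ∷ xs)
    ≡⟨⟩
  countᵇ (uncurry adjacent) (map (x ,_) xs ++ pairs xs)
    ≡⟨ countᵇ-++ (uncurry adjacent) (map (x ,_) xs) (pairs xs) ⟩
  countᵇ (uncurry adjacent) (map (x ,_) xs) + edgeCount xs
    ≡⟨ cong (_+ edgeCount xs) (countᵇ-map (uncurry adjacent) (x ,_) xs) ⟩
  countᵇ (adjacent x) xs + edgeCount xs
    ∎

edgeCount-++ : ∀ {n} (xs ys : List (BinStr n)) →
               edgeCount (xs ++ ys) ≡ edgeCount xs + edgeCount ys + crossEdgeCount xs ys
edgeCount-++ [] ys = sym (+-identityʳ (edgeCount ys))
edgeCount-++ (x ∷ xs) ys = begin
  edgeCount (x ∷ xs ++ ys)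
    ≡⟨ edgeCount-∷ x (xs ++ ys) ⟩
  countᵇ (adjacent x) (xs ++ ys) + edgeCount (xs ++ ys)
    ≡⟨ cong₂ _+_ (countᵇ-++ (adjacent x) xs ys) (edgeCount-++ xs ys) ⟩
  countᵇ (adjacent x) xs + countᵇ (adjacent x) ys + (edgeCount xs + edgeCount ys + crossEdgeCount xs ys)
    ≡⟨ rearrange (countᵇ (adjacent x) xs) (countᵇ (adjacent x) ys) (edgeCount xs) _ _ ⟩
  countᵇ (adjacent x) xs + edgeCount xs + edgeCount ys + crossEdgeCount (x ∷ xs) ys
    ≡⟨ cong (λ k → k + edgeCount ys + crossEdgeCount (x ∷ xs) ys) (sym (edgeCount-∷ x xs)) ⟩
  edgeCount (x ∷ xs) + edgeCount ys + crossEdgeCount (x ∷ xs) ys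
    ∎
  where
  rearrange : ∀ a b c d e → a + b + (c + d + e) ≡ a + c + d + (b + e)
  rearrange = solve-∀

edgeCount-map : ∀ {m n} (f : BinStr m → BinStr n) → (∀ x y → adjacent (f x) (f y) ≡ adjacent x y) →
                ∀ xs → edgeCount (map f xs) ≡ edgeCount xs
edgeCount-map f f-adj [] = refl
edgeCount-map f f-adj (x ∷ xs) = begin
  edgeCount (f x ∷ map f xs)
    ≡⟨ edgeCount-∷ (f x) (map f xs) ⟩
  countᵇ (adjacent (f x)) (map f xs) + edgeCount (map f xs)
    ≡⟨ cong₂ _+_ (countᵇ-map (adjacent (f x)) f xs) (edgeCount-map f f-adj xs) ⟩
  countᵇ (adjacent (f x) ∘ f) xs + edgeCount xs
    ≡⟨ cong (λ ys → length ys + edgeCount xs) (filterᵇ-cong (f-adj x) xs) ⟩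
  countᵇ (adjacent x) xs + edgeCount xs
    ≡⟨ edgeCount-∷ x xs ⟨
  edgeCount (x ∷ xs)
    ∎

adjacent-∷ : ∀ {n} b (x y : BinStr n) → adjacent (b ∷ x) (b ∷ y) ≡ adjacent x y
adjacent-∷ false x y = refl
adjacent-∷ true  x y = refl

filterᵇ-allStrings : ∀ n (P : BinStr (suc n) → Bool) →
  filterᵇ P (allStrings (suc n)) ≡
    map (false ∷_) (filterᵇ (P ∘ (false ∷_)) (allStrings n)) ++
    map (true ∷_) (filterᵇ (P ∘ (true ∷_)) (allStrings n))
filterᵇ-allStrings n P = trans (filter-++ (T? ∘ P) (map (false ∷_) (allStrings n)) _)
  (cong₂ _++_ (filterᵇ-map P (false ∷_) (allStrings n)) (filterᵇ-map P (true ∷_) (allStrings n)))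

sameᵇ : ∀ {n} → BinStr n → BinStr n → Bool
sameᵇ x y = hamming x y ≡ᵇ 0

filterᵇ-sameᵇ-allStrings : ∀ {n} (x : BinStr n) → filterᵇ (sameᵇ x) (allStrings n) ≡ x ∷ []
filterᵇ-sameᵇ-allStrings [] = refl
filterᵇ-sameᵇ-allStrings {suc n} (false ∷ x) = begin
  filterᵇ (sameᵇ (false ∷ x)) (allStrings (suc n))
    ≡⟨ filterᵇ-allStrings n (sameᵇ (false ∷ x)) ⟩
  map (false ∷_) (filterᵇ (sameᵇ x) (allStrings n)) ++ map (true ∷_) (filterᵇ (λ _ → false) (allStrings n))
    ≡⟨ cong₂ (λ ys zs → map (false ∷_) ys ++ map (true ∷_) zs)
             (filterᵇ-sameᵇ-allStrings x) (filterᵇ-false (allStrings n)) ⟩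
  (false ∷ x) ∷ []
    ∎
filterᵇ-sameᵇ-allStrings {suc n} (true ∷ x) = begin
  filterᵇ (sameᵇ (true ∷ x)) (allStrings (suc n))
    ≡⟨ filterᵇ-allStrings n (sameᵇ (true ∷ x)) ⟩
  map (false ∷_) (filterᵇ (λ _ → false) (allStrings n)) ++ map (true ∷_) (filterᵇ (sameᵇ x) (allStrings n))
    ≡⟨ cong₂ (λ ys zs → map (false ∷_) ys ++ map (true ∷_) zs)
             (filterᵇ-false (allStrings n)) (filterᵇ-sameᵇ-allStrings x) ⟩
  (true ∷ x) ∷ []
    ∎

crossEdgeCount-faces : ∀ {n} (xs : List (BinStr n)) (Q : BinStr n → Bool) →
  crossEdgeCount (map (false ∷_) xs) (map (true ∷_) (filterᵇ Q (allStrings n))) ≡ countᵇ Q xs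
crossEdgeCount-faces {n} xs Q = begin
  sum (map (λ x → countᵇ (adjacent x) ys₁) (map (false ∷_) xs))
    ≡⟨ cong sum (map-∘ xs) ⟨
  sum (map (λ x → countᵇ (adjacent (false ∷ x)) ys₁) xs)
    ≡⟨ cong sum (map-cong matched xs) ⟩
  sum (map (λ x → countᵇ Q (x ∷ [])) xs)
    ≡⟨ sum-countᵇ-singleton Q xs ⟩
  countᵇ Q xs
    ∎
  where
  ys₁ = map (true ∷_) (filterᵇ Q (allStrings n))
  -- 0x and 1y are adjacent exactly when x = y
  matched : ∀ x → countᵇ (adjacent (false ∷ x)) ys₁ ≡ countᵇ Q (x ∷ [])
  matched x = begin
    countᵇ (adjacent (false ∷ x)) ys₁
      ≡⟨ countᵇ-map (adjacent (false ∷ x)) (true ∷_) (filterᵇ Q (allStrings n)) ⟩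
    countᵇ (sameᵇ x) (filterᵇ Q (allStrings n))
      ≡⟨ cong length (filterᵇ-comm (sameᵇ x) Q (allStrings n)) ⟩
    countᵇ Q (filterᵇ (sameᵇ x) (allStrings n))
      ≡⟨ cong (countᵇ Q) (filterᵇ-sameᵇ-allStrings x) ⟩
    countᵇ Q (x ∷ [])
      ∎

Fib-aux-fuel : ∀ p {k k′} n → n ≤ k → n ≤ k′ → Fib-aux p k n ≡ Fib-aux p k′ n
Fib-aux-fuel p {zero}  {zero}   zero _ _ = refl
Fib-aux-fuel p {zero}  {suc _}  zero _ _ = refl
Fib-aux-fuel p {suc _} {zero}   zero _ _ = refl
Fib-aux-fuel p {suc _} {suc _}  zero _ _ = refl
Fib-aux-fuel p {suc k} {suc k′} (suc m) (s≤s m≤k) (s≤s m≤k′) =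
  cong₂ (λ a b → if p <ᵇ suc m then a + b else 1)
        (Fib-aux-fuel p m m≤k m≤k′)
        (Fib-aux-fuel p (m ∸ p) (≤-trans (m∸n≤m m p) m≤k) (≤-trans (m∸n≤m m p) m≤k′))

F-one : ∀ {p k} → 1 ≤ k → k ≤ p → F p k ≡ 1
F-one {p} {suc m} _ k≤p with p <ᵇ suc m | <ᵇ-reflects-< p (suc m)
... | false | _        = refl
... | true  | ofʸ p<k = contradiction k≤p (<⇒≱ p<k)

F-rec : ∀ p {m} → 1 ≤ m → F p (suc m) ≡ F p m + F p (m ∸ p)
F-rec p {m} 1≤m with p <ᵇ suc m | <ᵇ-reflects-< p (suc m)
... | true  | _        = cong (F p m +_) (Fib-aux-fuel p (m ∸ p) (m∸n≤m m p) ≤-refl)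
... | false | ofⁿ p≮1+m = sym (cong₂ _+_ (F-one 1≤m m≤p) (cong (F p) (m≤n⇒m∸n≡0 m≤p)))
  where
  m≤p : m ≤ p
  m≤p = <⇒≤ (≮⇒≥ p≮1+m)

F-suc-self : ∀ {p} → 1 ≤ p → F p (suc p) ≡ 1
F-suc-self {p} 1≤p = begin
  F p (suc p)          ≡⟨ F-rec p 1≤p ⟩
  F p p + F p (p ∸ p)  ≡⟨ cong₂ _+_ (F-one 1≤p ≤-refl) (cong (F p) (n∸n≡0 p)) ⟩
  1                    ∎

sum1-cong : ∀ m {f g : ℕ → ℕ} → (∀ {i} → 1 ≤ i → i ≤ m → f i ≡ g i) → sum1 m f ≡ sum1 m g
sum1-cong zero    _   = refl
sum1-cong (suc m) f≗g =
  cong₂ _+_ (sum1-cong m (λ 1≤i i≤m → f≗g 1≤i (m≤n⇒m≤1+n i≤m))) (f≗g (s≤s z≤n) ≤-refl)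

sum1-+ : ∀ m (f g : ℕ → ℕ) → sum1 m (λ i → f i + g i) ≡ sum1 m f + sum1 m g
sum1-+ zero    f g = refl
sum1-+ (suc m) f g = trans (cong (_+ (f (suc m) + g (suc m))) (sum1-+ m f g))
                           (interchange (sum1 m f) (sum1 m g) (f (suc m)) (g (suc m)))

conv : (ℕ → ℕ) → (ℕ → ℕ) → ℕ → ℕ
conv f g m = sum1 m (λ i → f i * g (m ∸ i))

conv-cong : ∀ f {g h} m → g ≗ h → conv f g m ≡ conv f h m
conv-cong f m g≗h = sum1-cong m (λ {i} _ _ → cong (f i *_) (g≗h (m ∸ i)))

conv-+ : ∀ f g h m → conv f (λ j → g j + h j) m ≡ conv f g m + conv f h m
conv-+ f g h m = trans (sum1-cong m (λ {i} _ _ → *-distribˡ-+ (f i) (g (m ∸ i)) (h (m ∸ i))))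
                       (sum1-+ m _ _)

conv-suc : ∀ f g m → conv f g (suc m) ≡ conv f (g ∘ suc) m + f (suc m) * g 0
conv-suc f g m =
  cong₂ _+_ (sum1-cong m (λ {i} _ i≤m → cong (λ k → f i * g k) (+-∸-assoc 1 i≤m)))
            (cong (λ k → f (suc m) * g k) (n∸n≡0 m))

conv-∸ : ∀ (f g : ℕ → ℕ) → g 0 ≡ 0 → ∀ d m → conv f (λ j → g (j + 1 ∸ d)) m ≡ conv f (λ j → g (j + 1)) (m ∸ d)
conv-∸ f g g0≡0 zero    m       = refl
conv-∸ f g g0≡0 (suc d) zero    = refl
conv-∸ f g g0≡0 (suc d) (suc m) = begin
  conv f (λ j → g (j + 1 ∸ suc d)) (suc m)
    ≡⟨ conv-suc f (λ j → g (j + 1 ∸ suc d)) m ⟩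
  conv f (λ j → g (j + 1 ∸ d)) m + f (suc m) * g (0 ∸ d)
    ≡⟨ cong₂ _+_ (conv-∸ f g g0≡0 d m) (cong (λ k → f (suc m) * g k) (0∸n≡0 d)) ⟩
  conv f (λ j → g (j + 1)) (m ∸ d) + f (suc m) * g 0
    ≡⟨ cong (conv f (λ j → g (j + 1)) (m ∸ d) +_) (trans (cong (f (suc m) *_) g0≡0) (*-zeroʳ (f (suc m)))) ⟩
  conv f (λ j → g (j + 1)) (m ∸ d) + 0
    ≡⟨ +-identityʳ _ ⟩
  conv f (λ j → g (j + 1)) (m ∸ d)
    ∎

fibConv : ℕ → ℕ → ℕ
fibConv p = conv (F p) (λ j → F p (j + 1))

fibConv-suc : ∀ {p} → 1 ≤ p → ∀ m → fibConv p (suc m) ≡ fibConv p m + fibConv p (m ∸ p) + F p (suc m)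
fibConv-suc {p} 1≤p m = begin
  fibConv p (suc m)
    ≡⟨ conv-suc (F p) (λ j → F p (j + 1)) m ⟩
  conv (F p) (λ j → F p (suc (j + 1))) m + F p (suc m) * F p 1
    ≡⟨ cong₂ _+_ (conv-cong (F p) m (λ j → F-rec p (m≤n+m 1 j)))
                 (cong (F p (suc m) *_) (F-one ≤-refl 1≤p)) ⟩
  conv (F p) (λ j → F p (j + 1) + F p (j + 1 ∸ p)) m + F p (suc m) * 1
    ≡⟨ cong₂ _+_ (conv-+ (F p) (λ j → F p (j + 1)) (λ j → F p (j + 1 ∸ p)) m) (*-identityʳ _) ⟩
  fibConv p m + conv (F p) (λ j → F p (j + 1 ∸ p)) m + F p (suc m)
    ≡⟨ cong (λ k → fibConv p m + k + F p (suc m)) (conv-∸ (F p) (F p) refl p m) ⟩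
  fibConv p m + fibConv p (m ∸ p) + F p (suc m)
    ∎

module FibonacciStrings (p : ℕ) where

  -- accepts s u: u is a Fibonacci p-string whose first s letters are 0
  -- (s counts the 0s still owed before the next 1).
  accepts : ℕ → ∀ {n} → BinStr n → Bool
  accepts s       []          = true
  accepts s       (false ∷ u) = accepts (pred s) u
  accepts zero    (true ∷ u)  = accepts p u
  accepts (suc _) (true ∷ u)  = false

  zerosOwed : Maybe ℕ → ℕ
  zerosOwed nothing  = 0
  zerosOwed (just g) = p ∸ g

  fibCheck≡accepts : ∀ gap {n} (u : BinStr n) → fibCheck p gap u ≡ accepts (zerosOwed gap) u
  fibCheck≡accepts gap      []          = refl
  fibCheck≡accepts nothing  (false ∷ u) = fibCheck≡accepts nothing u
  fibCheck≡accepts (just g) (false ∷ u) =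
    trans (fibCheck≡accepts (just (suc g)) u) (cong (λ s → accepts s u) (sym (pred[m∸n]≡m∸[1+n] p g)))
  fibCheck≡accepts nothing  (true ∷ u)  = fibCheck≡accepts (just 0) u
  fibCheck≡accepts (just g) (true ∷ u) with p ≤ᵇ g | ≤ᵇ-reflects-≤ p g
  ... | true  | ofʸ p≤g rewrite m≤n⇒m∸n≡0 p≤g = fibCheck≡accepts (just 0) u
  ... | false | ofⁿ p≰g with p ∸ g | m<n⇒0<n∸m (≰⇒> p≰g)
  ...   | suc _ | _ = refl

  accepts⇒accepts-zero : ∀ s {n} (u : BinStr n) → T (accepts s u) → T (accepts 0 u)
  accepts⇒accepts-zero s       []          _ = _
  accepts⇒accepts-zero zero    (false ∷ u) h = h
  accepts⇒accepts-zero (suc s) (false ∷ u) h = accepts⇒accepts-zero s u h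
  accepts⇒accepts-zero zero    (true ∷ u)  h = h

  fibStrings : ℕ → (n : ℕ) → List (BinStr n)
  fibStrings s n = filterᵇ (accepts s) (allStrings n)

  vertices≡fibStrings : ∀ n → vertices p n ≡ fibStrings 0 n
  vertices≡fibStrings n = filterᵇ-cong (fibCheck≡accepts nothing) (allStrings n)

  fibStrings-suc-suc : ∀ s n → fibStrings (suc s) (suc n) ≡ map (false ∷_) (fibStrings s n)
  fibStrings-suc-suc s n = begin
    fibStrings (suc s) (suc n)
      ≡⟨ filterᵇ-allStrings n (accepts (suc s)) ⟩
    map (false ∷_) (fibStrings s n) ++ map (true ∷_) (filterᵇ (λ _ → false) (allStrings n))
      ≡⟨ cong (λ zs → map (false ∷_) (fibStrings s n) ++ map (true ∷_) zs) (filterᵇ-false (allStrings n)) ⟩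
    map (false ∷_) (fibStrings s n) ++ []
      ≡⟨ ++-identityʳ _ ⟩
    map (false ∷_) (fibStrings s n)
      ∎

  fibStrings-zero-suc : ∀ n → fibStrings 0 (suc n) ≡ map (false ∷_) (fibStrings 0 n) ++ map (true ∷_) (fibStrings p n)
  fibStrings-zero-suc n = filterᵇ-allStrings n (accepts 0)

  length-fibStrings : 1 ≤ p → ∀ n s → s ≤ p → length (fibStrings s n) ≡ F p (suc n + p ∸ s)
  length-fibStrings 1≤p zero    zero    _   = sym (F-suc-self 1≤p)
  length-fibStrings 1≤p zero    (suc s) s<p = sym (F-one (m<n⇒0<n∸m s<p) (m∸n≤m p s))
  length-fibStrings 1≤p (suc n) (suc s) s<p = begin
    length (fibStrings (suc s) (suc n))  ≡⟨ cong length (fibStrings-suc-suc s n) ⟩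
    length (map (false ∷_) (fibStrings s n)) ≡⟨ length-map (false ∷_) (fibStrings s n) ⟩
    length (fibStrings s n)              ≡⟨ length-fibStrings 1≤p n s (<⇒≤ s<p) ⟩
    F p (suc n + p ∸ s)                  ∎
  length-fibStrings 1≤p (suc n) zero    _   = begin
    length (fibStrings 0 (suc n))
      ≡⟨ cong length (fibStrings-zero-suc n) ⟩
    length (map (false ∷_) (fibStrings 0 n) ++ map (true ∷_) (fibStrings p n))
      ≡⟨ length-++ (map (false ∷_) (fibStrings 0 n)) ⟩
    length (map (false ∷_) (fibStrings 0 n)) + length (map (true ∷_) (fibStrings p n))
      ≡⟨ cong₂ _+_ (length-map (false ∷_) (fibStrings 0 n)) (length-map (true ∷_) (fibStrings p n)) ⟩
    length (fibStrings 0 n) + length (fibStrings p n)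
      ≡⟨ cong₂ _+_ (length-fibStrings 1≤p n 0 z≤n) (length-fibStrings 1≤p n p ≤-refl) ⟩
    F p (suc n + p) + F p (suc n + p ∸ p)
      ≡⟨ F-rec p (s≤s z≤n) ⟨
    F p (suc (suc n + p))
      ∎

  crossEdgeCount-fibStrings : 1 ≤ p → ∀ n →
    crossEdgeCount (map (false ∷_) (fibStrings 0 n)) (map (true ∷_) (fibStrings p n)) ≡ F p (suc n)
  crossEdgeCount-fibStrings 1≤p n = begin
    crossEdgeCount (map (false ∷_) (fibStrings 0 n)) (map (true ∷_) (fibStrings p n))
      ≡⟨ crossEdgeCount-faces (fibStrings 0 n) (accepts p) ⟩
    countᵇ (accepts p) (fibStrings 0 n)
      ≡⟨ cong length (filterᵇ-absorb (accepts⇒accepts-zero p) (allStrings n)) ⟩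
    length (fibStrings p n)
      ≡⟨ length-fibStrings 1≤p n p ≤-refl ⟩
    F p (suc n + p ∸ p)
      ≡⟨ cong (F p) (m+n∸n≡m (suc n) p) ⟩
    F p (suc n)
      ∎

  edgeCount-fibStrings : 1 ≤ p → ∀ n s → edgeCount (fibStrings s n) ≡ fibConv p (n ∸ s)
  edgeCount-fibStrings 1≤p zero    s       = sym (cong (fibConv p) (0∸n≡0 s))
  edgeCount-fibStrings 1≤p (suc n) (suc s) = begin
    edgeCount (fibStrings (suc s) (suc n))     ≡⟨ cong edgeCount (fibStrings-suc-suc s n) ⟩
    edgeCount (map (false ∷_) (fibStrings s n)) ≡⟨ edgeCount-map (false ∷_) (adjacent-∷ false) (fibStrings s n) ⟩
    edgeCount (fibStrings s n)                  ≡⟨ edgeCount-fibStrings 1≤p n s ⟩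
    fibConv p (n ∸ s)                           ∎
  edgeCount-fibStrings 1≤p (suc n) zero    = begin
    edgeCount (fibStrings 0 (suc n))
      ≡⟨ cong edgeCount (fibStrings-zero-suc n) ⟩
    edgeCount (map (false ∷_) (fibStrings 0 n) ++ map (true ∷_) (fibStrings p n))
      ≡⟨ edgeCount-++ (map (false ∷_) (fibStrings 0 n)) (map (true ∷_) (fibStrings p n)) ⟩
    edgeCount (map (false ∷_) (fibStrings 0 n)) + edgeCount (map (true ∷_) (fibStrings p n))
      + crossEdgeCount (map (false ∷_) (fibStrings 0 n)) (map (true ∷_) (fibStrings p n))
      ≡⟨ cong₂ _+_ (cong₂ _+_ (edgeCount-map (false ∷_) (adjacent-∷ false) (fibStrings 0 n))
                              (edgeCount-map (true ∷_) (adjacent-∷ true) (fibStrings p n)))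
                   (crossEdgeCount-fibStrings 1≤p n) ⟩
    edgeCount (fibStrings 0 n) + edgeCount (fibStrings p n) + F p (suc n)
      ≡⟨ cong (λ k → k + F p (suc n)) (cong₂ _+_ (edgeCount-fibStrings 1≤p n 0) (edgeCount-fibStrings 1≤p n p)) ⟩
    fibConv p n + fibConv p (n ∸ p) + F p (suc n)
      ≡⟨ fibConv-suc 1≤p n ⟨
    fibConv p (suc n)
      ∎

theorem4p2 : (p n : ℕ) → 1 ≤ p → p + 1 ≤ n →
    length (edges p n) ≡ sum1 n (λ i → F p i * F p (n ∸ i + 1))
theorem4p2 p n 1≤p _ = begin
  length (edges p n)          ≡⟨⟩
  edgeCount (vertices p n)    ≡⟨ cong edgeCount (vertices≡fibStrings n) ⟩
  edgeCount (fibStrings 0 n)  ≡⟨ edgeCount-fibStrings 1≤p n 0 ⟩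
  fibConv p n                 ∎
  where open FibonacciStrings p
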